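{- Let $\mathcal{G}$ be a class of graphs which is closed under deletion of edges. Suppose that for every $G\in\mathcal{G}$, all non-adjacent distinct vertices $s,t\in V(G)$ and all integers $k\geq 0$, $l\geq 1$ such that $(k,l)$ is a connectivity pair for $s$ and $t$ in $G$, there exist $k+l$ pairwise edge-disjoint $s$-$t$ paths in $G$ of which $k+1$ are internally disjoint. Then the same conclusion holds for every $G\in\mathcal{G}$ and all distinct vertices $s,t\in V(G)$ (adjacent or not) and all integers $k\geq0$, $l\geq 1$ such that $(k,l)$ is a connectivity pair for $s$ and $t$ in $G$.
   Context: Graphs are finite and may contain parallel edges but no loops. For distinct $s,t$, an $s$-$t$ disconnecting pair is a pair $(W,F)$ with $W\subseteq V(G)\setminus\{s,t\}$, $F\subseteq E(G)$, such that $s$ and $t$ are not connected in $G-W-F$; its order is $|W|$, its size $|F|$, its cardinality $|W|+|F|$. An ordered pair $(k,l)$ of non-negative integers is a connectivity pair for $s$ and $t$ if there exists an $s$-$t$ disconnecting pair of order $k$ and size $l$, and there is no $s$-$t$ disconnecting pair of cardinality less than $k+l$ with order at most $k$ and size at most $l$. Internally disjoint $s$-$t$ paths share only $s$ and $t$. -}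

module Defs where

open import Data.Nat using (ℕ; zero; suc; _+_; _≤_; _<_)
open import Data.Fin using (Fin; toℕ; inject₁; fromℕ; punchIn)
import Data.Fin as Fin
open import Data.Fin.Subset using (Subset; _∈_; _∉_; ∣_∣)
open import Data.Product using (Σ; _×_; _,_; proj₁; proj₂; ∃)
open import Data.Sum using (_⊎_)
open import Relation.Binary.PropositionalEquality using (_≡_; _≢_)
open import Relation.Nullary using (¬_)
open import Function.Definitions using (Injective)

-- A finite multigraph without loops: vertices Fin n, edges Fin m,
-- each edge has two distinct endpoints; parallel edges allowed.
record Graph : Set where
  field
    n     : ℕ
    m     : ℕ
    ends  : Fin m → Fin n × Fin n
    noLoop : ∀ e → proj₁ (ends e) ≢ proj₂ (ends e)
open Graph public

V : Graph → Set
V G = Fin (n G)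

E : Graph → Set
E G = Fin (m G)

Joins : (G : Graph) → E G → V G → V G → Set
Joins G e u v = (proj₁ (ends G e) ≡ u × proj₂ (ends G e) ≡ v)
              ⊎ (proj₁ (ends G e) ≡ v × proj₂ (ends G e) ≡ u)

Adjacent : (G : Graph) → V G → V G → Set
Adjacent G u v = Σ (E G) λ e → Joins G e u v

deleteEdge : (G : Graph) → (m′ : ℕ) → m G ≡ suc m′ → Fin (m G) → Graph
deleteEdge record { n = n ; m = .(suc m′) ; ends = ends ; noLoop = noLoop } m′ _≡_.refl e =
  record { n = n ; m = m′ ; ends = λ i → ends (punchIn e i) ; noLoop = λ i → noLoop (punchIn e i) }

ClosedUnderEdgeDeletion : (Graph → Set) → Set
ClosedUnderEdgeDeletion 𝒢 =
  ∀ G → 𝒢 G → (m′ : ℕ) (eq : m G ≡ suc m′) (e : E G) → 𝒢 (deleteEdge G m′ eq e)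

record Path (G : Graph) (s t : V G) : Set where
  field
    len   : ℕ
    verts : Fin (suc len) → V G
    edges : Fin len → E G
    start : verts Fin.zero ≡ s
    end   : verts (fromℕ len) ≡ t
    simple : Injective _≡_ _≡_ verts
    step  : ∀ i → Joins G (edges i) (verts (inject₁ i)) (verts (Fin.suc i))
open Path public

EdgeDisjoint : {G : Graph} {s t : V G} → Path G s t → Path G s t → Set
EdgeDisjoint P Q = ∀ i j → edges P i ≢ edges Q j

InternallyDisjoint : {G : Graph} {s t : V G} → Path G s t → Path G s t → Set
InternallyDisjoint {s = s} {t} P Q =
  ∀ i j → verts P i ≡ verts Q j → verts P i ≡ s ⊎ verts P i ≡ t

-- (W,F) is an s-t disconnecting pair: W ⊆ V ∖ {s,t}, F ⊆ E, and no s-t path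
-- in G - W - F (i.e. no s-t path avoiding the vertices of W and the edges of F).
record Disconnecting (G : Graph) (s t : V G) (W : Subset (n G)) (F : Subset (m G)) : Set where
  field
    s∉W : s ∉ W
    t∉W : t ∉ W
    separates : ¬ (Σ (Path G s t) λ P →
                   (∀ i → verts P i ∉ W) × (∀ i → edges P i ∉ F))

record ConnectivityPair (G : Graph) (s t : V G) (k l : ℕ) : Set where
  field
    witness : Σ (Subset (n G)) λ W → Σ (Subset (m G)) λ F →
              Disconnecting G s t W F × ∣ W ∣ ≡ k × ∣ F ∣ ≡ l
    minimal : ∀ W F → Disconnecting G s t W F → ∣ W ∣ ≤ k → ∣ F ∣ ≤ l →
              ¬ (∣ W ∣ + ∣ F ∣ < k + l)

-- there exist k+l pairwise edge-disjoint s-t paths, of which (the first) k+1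
-- are pairwise internally disjoint
PathSystem : (G : Graph) (s t : V G) (k l : ℕ) → Set
PathSystem G s t k l =
  Σ (Fin (k + l) → Path G s t) λ P →
    (∀ i j → i ≢ j → EdgeDisjoint (P i) (P j)) ×
    (∀ i j → toℕ i ≤ k → toℕ j ≤ k → i ≢ j → InternallyDisjoint (P i) (P j))

Property : (G : Graph) (s t : V G) → Set
Property G s t = ∀ k l → 1 ≤ l → ConnectivityPair G s t k l → PathSystem G s t k l

module Submission where

-- Adjacent terminals reduce to non-adjacent ones by induction on the
-- number of edges.  If e is an s–t edge, it lies in the edge set of every
-- s–t disconnecting pair, so a connectivity pair (k, l+1) of G becomes the
-- connectivity pair (k, l) of G - e, and a path system of G - e together
-- with the one-edge path e is a path system of G.  The delicate case is
-- l = 0: then (k, 0) is a connectivity pair of G - e, so s and t are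
-- non-adjacent in G - e, and for k = k'+1 a minimisation argument with an
-- exchange step (swap a cut edge for one of its inner endpoints) produces
-- a connectivity pair (k', b) of G - e with b ≥ 1.  Its path system has
-- k'+1 internally disjoint paths, which e completes to k+1 such paths.

open import Defs
open import Data.Nat using (ℕ; zero; suc; _+_; _≤_; _<_; z≤n; s≤s; _≤?_)
open import Data.Nat.Properties
  using (≤-refl; ≤-trans; ≤-antisym; ≤-pred; n≤1+n; m≤n⇒m≤1+n; <⇒≢; <-irrefl; ≮⇒≥;
         +-suc; +-comm; +-identityʳ; +-monoʳ-≤; +-monoˡ-<; suc-injective; m<1+n⇒m<n∨m≡n; anyUpTo?)
import Data.Fin as Fin
open import Data.Fin using (Fin; toℕ; inject₁; fromℕ; punchIn; punchOut; inject≤)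
open import Data.Fin.Properties
  using (any?; all?; _≟_; injective⇒≤; punchInᵢ≢i; punchIn-injective; punchIn-punchOut;
         toℕ-inject≤; inject≤-injective)
open import Data.Fin.Subset using (Subset; inside; outside; _∈_; _∉_; ∣_∣; _∪_; ⁅_⁆; _-_; ⊥; ⊤; Nonempty)
open import Data.Fin.Subset.Properties
  using (_∈?_; anySubset?; ∉⊥; ∈⊤; ∣p∣≤n; ∣⊥∣≡0; ∣⁅x⁆∣≡1; x∈p∪q⁺; x∈p∪q⁻; x∈⁅y⁆⇒x≡y; x∈⁅x⁆;
         x∈p∧x≢y⇒x∈p-y; x∈p⇒∣p-x∣<∣p∣)
open import Data.Vec using ([]; _∷_; here; there; insertAt; removeAt)
open import Data.Vec.Properties using ([]=⇒lookup; lookup⇒[]=; insertAt-lookup; insertAt-punchIn; insertAt-removeAt)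
import Data.Vec.Functional as Vector
open import Data.Product using (Σ; _×_; _,_; proj₁; proj₂; ∃)
open import Data.Sum using (_⊎_; inj₁; inj₂)
open import Data.Empty using () renaming (⊥ to Empty; ⊥-elim to contradiction)
open import Relation.Binary.PropositionalEquality
open import Relation.Nullary using (¬_; Dec; yes; no)
open import Relation.Nullary.Decidable using (_×-dec_; _⊎-dec_; _→-dec_; ¬?; map′)
open import Function.Definitions using (Injective)

∣insertAt-inside∣ : ∀ {k} (p : Subset k) (i : Fin (suc k)) → ∣ insertAt p i inside ∣ ≡ suc ∣ p ∣
∣insertAt-inside∣ p Fin.zero = refl
∣insertAt-inside∣ (inside ∷ p) (Fin.suc i) = cong suc (∣insertAt-inside∣ p i)
∣insertAt-inside∣ (outside ∷ p) (Fin.suc i) = ∣insertAt-inside∣ p i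

i∈insertAt : ∀ {k} (p : Subset k) (i : Fin (suc k)) → i ∈ insertAt p i inside
i∈insertAt p i = lookup⇒[]= i _ (insertAt-lookup p i inside)

∈insertAt⁺ : ∀ {k} {p : Subset k} (i : Fin (suc k)) {j} → j ∈ p → punchIn i j ∈ insertAt p i inside
∈insertAt⁺ {p = p} i {j} j∈p = lookup⇒[]= _ _ (trans (insertAt-punchIn p i inside j) ([]=⇒lookup j∈p))

∈insertAt⁻ : ∀ {k} {p : Subset k} (i : Fin (suc k)) {j} → punchIn i j ∈ insertAt p i inside → j ∈ p
∈insertAt⁻ {p = p} i {j} h = lookup⇒[]= j p (trans (sym (insertAt-punchIn p i inside j)) ([]=⇒lookup h))

insertAt-removeAt-∈ : ∀ {k} {p : Subset (suc k)} {i} → i ∈ p → insertAt (removeAt p i) i inside ≡ p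
insertAt-removeAt-∈ {p = p} {i} i∈p =
  subst (λ side → insertAt (removeAt p i) i side ≡ p) ([]=⇒lookup i∈p) (insertAt-removeAt p i)

∣p∪q∣≤∣p∣+∣q∣ : ∀ {k} (p q : Subset k) → ∣ p ∪ q ∣ ≤ ∣ p ∣ + ∣ q ∣
∣p∪q∣≤∣p∣+∣q∣ [] [] = z≤n
∣p∪q∣≤∣p∣+∣q∣ (inside ∷ p) (inside ∷ q) =
  s≤s (≤-trans (∣p∪q∣≤∣p∣+∣q∣ p q) (+-monoʳ-≤ ∣ p ∣ (n≤1+n ∣ q ∣)))
∣p∪q∣≤∣p∣+∣q∣ (inside ∷ p) (outside ∷ q) = s≤s (∣p∪q∣≤∣p∣+∣q∣ p q)
∣p∪q∣≤∣p∣+∣q∣ (outside ∷ p) (inside ∷ q) =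
  subst (suc ∣ p ∪ q ∣ ≤_) (sym (+-suc ∣ p ∣ ∣ q ∣)) (s≤s (∣p∪q∣≤∣p∣+∣q∣ p q))
∣p∪q∣≤∣p∣+∣q∣ (outside ∷ p) (outside ∷ q) = ∣p∪q∣≤∣p∣+∣q∣ p q

∈⇒positive : ∀ {k} {x : Fin k} {p : Subset k} → x ∈ p → 0 < ∣ p ∣
∈⇒positive {p = inside ∷ p} _ = s≤s z≤n
∈⇒positive {p = outside ∷ p} (there x∈p) = ∈⇒positive x∈p

positive⇒nonempty : ∀ {k} (p : Subset k) → 0 < ∣ p ∣ → Nonempty p
positive⇒nonempty (inside ∷ p) _ = Fin.zero , here
positive⇒nonempty (outside ∷ p) pos with positive⇒nonempty p pos
... | x , x∈p = Fin.suc x , there x∈p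

Least : (ℕ → Set) → Set
Least P = Σ ℕ λ a → P a × (∀ c → c < a → ¬ P c)

least : {P : ℕ → Set} → (∀ c → Dec (P c)) → ∀ {b} → P b → Least P
least {P} P? {b} Pb = scan 0 b (λ _ ()) (subst P (sym (+-identityʳ b)) Pb)
  where
  scan : ∀ d gap → (∀ c → c < d → ¬ P c) → P (gap + d) → Least P
  scan d zero below Pd = d , Pd , below
  scan d (suc gap) below Pgap+d with P? d
  ... | yes Pd = d , Pd , below
  ... | no ¬Pd = scan (suc d) gap below′ (subst P (sym (+-suc gap d)) Pgap+d)
    where
    below′ : ∀ c → c < suc d → ¬ P c
    below′ c c<1+d with m<1+n⇒m<n∨m≡n c<1+d
    ... | inj₁ c<d = below c c<d
    ... | inj₂ refl = ¬Pd

PointwiseInvariant : ∀ {a b} → ((Fin a → Fin b) → Set) → Set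
PointwiseInvariant P = ∀ {f g} → (∀ i → f i ≡ g i) → P f → P g

∃-function? : ∀ a {b} {P : (Fin a → Fin b) → Set} → PointwiseInvariant P → (∀ f → Dec (P f)) → Dec (∃ P)
∃-function? zero {b} {P} inv P? = map′ (λ p → empty , p) (λ (f , p) → inv {f} (λ ()) p) (P? empty)
  where
  empty : Fin 0 → Fin b
  empty ()
∃-function? (suc a) {b} {P} inv P? =
  map′ (λ (x , g , p) → x Vector.∷ g , p)
       (λ (f , p) → Vector.head f , Vector.tail f , inv head∷tail p)
       (any? λ x → ∃-function? a (λ f≗g → inv (cons≗ f≗g)) (λ g → P? (x Vector.∷ g)))
  where
  head∷tail : ∀ {f : Fin (suc a) → Fin b} i → f i ≡ (Vector.head f Vector.∷ Vector.tail f) i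
  head∷tail Fin.zero = refl
  head∷tail (Fin.suc i) = refl
  cons≗ : ∀ {x} {f g : Fin a → Fin b} → (∀ i → f i ≡ g i) → ∀ i → (x Vector.∷ f) i ≡ (x Vector.∷ g) i
  cons≗ f≗g Fin.zero = refl
  cons≗ f≗g (Fin.suc i) = f≗g i

injective? : ∀ {a b} (f : Fin a → Fin b) → Dec (Injective _≡_ _≡_ f)
injective? f = map′ (λ h {x} {y} → h x y) (λ h x y → h) (all? λ x → all? λ y → (f x ≟ f y) →-dec (x ≟ y))

joins? : (G : Graph) (e : E G) (u v : V G) → Dec (Joins G e u v)
joins? G e u v = ((proj₁ (ends G e) ≟ u) ×-dec (proj₂ (ends G e) ≟ v))
              ⊎-dec ((proj₁ (ends G e) ≟ v) ×-dec (proj₂ (ends G e) ≟ u))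

adjacent? : (G : Graph) (s t : V G) → Dec (Adjacent G s t)
adjacent? G s t = any? λ e → joins? G e s t

Avoids : {G : Graph} {s t : V G} → Subset (n G) → Subset (m G) → Path G s t → Set
Avoids W F P = (∀ i → verts P i ∉ W) × (∀ i → edges P i ∉ F)

module AvoidingPaths (G : Graph) (s t : V G) (W : Subset (n G)) (F : Subset (m G)) where

  Admissible : ∀ len → (Fin (suc len) → V G) → (Fin len → E G) → Set
  Admissible len vs es = vs Fin.zero ≡ s × vs (fromℕ len) ≡ t × Injective _≡_ _≡_ vs
                       × (∀ i → Joins G (es i) (vs (inject₁ i)) (vs (Fin.suc i)))
                       × (∀ i → vs i ∉ W) × (∀ i → es i ∉ F)

  admissible? : ∀ len vs es → Dec (Admissible len vs es)
  admissible? len vs es =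
    (vs Fin.zero ≟ s) ×-dec (vs (fromℕ len) ≟ t) ×-dec injective? vs
    ×-dec all? (λ i → joins? G (es i) (vs (inject₁ i)) (vs (Fin.suc i)))
    ×-dec all? (λ i → ¬? (vs i ∈? W)) ×-dec all? (λ i → ¬? (es i ∈? F))

  edgesInvariant : ∀ len vs → PointwiseInvariant (Admissible len vs)
  edgesInvariant len vs es≗ (s₀ , t₀ , inj , joins , avW , avF) =
    s₀ , t₀ , inj , (λ i → subst (λ f → Joins G f _ _) (es≗ i) (joins i)) , avW ,
    (λ i → subst (_∉ F) (es≗ i) (avF i))

  vertsInvariant : ∀ len → PointwiseInvariant (λ vs → ∃ (Admissible len vs))
  vertsInvariant len vs≗ (es , s₀ , t₀ , inj , joins , avW , avF) =
    es , trans (sym (vs≗ _)) s₀ , trans (sym (vs≗ _)) t₀ ,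
    (λ {x} {y} eq → inj (trans (vs≗ x) (trans eq (sym (vs≗ y))))) ,
    (λ i → subst₂ (Joins G (es i)) (vs≗ _) (vs≗ _) (joins i)) ,
    (λ i → subst (_∉ W) (vs≗ i) (avW i)) , avF

  -- Simple paths have fewer than n G edges, so a bounded search suffices.
  avoidingPath? : Dec (Σ (Path G s t) (Avoids W F))
  avoidingPath? =
    map′ toPath fromPath
      (anyUpTo? (λ len → ∃-function? (suc len) (vertsInvariant len)
                           (λ vs → ∃-function? len (edgesInvariant len vs) (admissible? len vs)))
                (n G))
    where
    toPath : (∃ λ len → len < n G × ∃ λ vs → ∃ (Admissible len vs)) → Σ (Path G s t) (Avoids W F)
    toPath (len , _ , vs , es , s₀ , t₀ , inj , joins , avW , avF) =
      record { len = len ; verts = vs ; edges = es ; start = s₀ ; end = t₀ ; simple = inj ; step = joins }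
      , avW , avF
    fromPath : Σ (Path G s t) (Avoids W F) → ∃ λ len → len < n G × ∃ λ vs → ∃ (Admissible len vs)
    fromPath (P , avW , avF) =
      len P , injective⇒≤ (simple P) , verts P , edges P ,
      start P , end P , (λ {x} {y} → simple P {x} {y}) , step P , avW , avF

disconnecting? : (G : Graph) (s t : V G) (W : Subset (n G)) (F : Subset (m G)) → Dec (Disconnecting G s t W F)
disconnecting? G s t W F =
  map′ (λ (s∉W , t∉W , sep) → record { s∉W = s∉W ; t∉W = t∉W ; separates = sep })
       (λ d → Disconnecting.s∉W d , Disconnecting.t∉W d , Disconnecting.separates d)
       (¬? (s ∈? W) ×-dec ¬? (t ∈? W) ×-dec ¬? (AvoidingPaths.avoidingPath? G s t W F))

module _ {G : Graph} {s t : V G} where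

  edgePath : s ≢ t → (e : E G) → Joins G e s t → Path G s t
  edgePath s≢t e J = record { len = 1 ; verts = vs ; edges = λ _ → e ; start = refl ; end = refl
                            ; simple = λ {x} {y} → inj x y ; step = λ { Fin.zero → J } }
    where
    vs : Fin 2 → V G
    vs Fin.zero = s
    vs (Fin.suc Fin.zero) = t
    inj : ∀ x y → vs x ≡ vs y → x ≡ y
    inj Fin.zero Fin.zero _ = refl
    inj Fin.zero (Fin.suc Fin.zero) s≡t = contradiction (s≢t s≡t)
    inj (Fin.suc Fin.zero) Fin.zero t≡s = contradiction (s≢t (sym t≡s))
    inj (Fin.suc Fin.zero) (Fin.suc Fin.zero) _ = refl

  edgePath-verts : ∀ s≢t e J j → verts (edgePath s≢t e J) j ≡ s ⊎ verts (edgePath s≢t e J) j ≡ t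
  edgePath-verts s≢t e J Fin.zero = inj₁ refl
  edgePath-verts s≢t e J (Fin.suc Fin.zero) = inj₂ refl

  edge∈cut : s ≢ t → ∀ {W F e} → Joins G e s t → Disconnecting G s t W F → e ∈ F
  edge∈cut s≢t {W} {F} {e} J d with e ∈? F
  ... | yes e∈F = e∈F
  ... | no e∉F = contradiction (Disconnecting.separates d (edgePath s≢t e J , avoidsW , λ _ → e∉F))
    where
    avoidsW : ∀ i → verts (edgePath s≢t e J) i ∉ W
    avoidsW Fin.zero = Disconnecting.s∉W d
    avoidsW (Fin.suc Fin.zero) = Disconnecting.t∉W d

  vertexCut⇒nonadjacent : s ≢ t → ∀ {k} → ConnectivityPair G s t k 0 → ¬ Adjacent G s t
  vertexCut⇒nonadjacent s≢t cp (e , J) with ConnectivityPair.witness cp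
  ... | W , F , d , _ , ∣F∣≡0 = <⇒≢ (∈⇒positive (edge∈cut s≢t J d)) (sym ∣F∣≡0)

  allEdgesCut : s ≢ t → Disconnecting G s t ⊥ ⊤
  allEdgesCut s≢t = record { s∉W = ∉⊥ ; t∉W = ∉⊥
                           ; separates = λ (P , _ , avoidsF) →
                               s≢t (edgeless (len P) (verts P) (edges P) (start P) (end P) avoidsF) }
    where
    edgeless : ∀ l (vs : Fin (suc l) → V G) (es : Fin l → E G) →
               vs Fin.zero ≡ s → vs (fromℕ l) ≡ t → (∀ i → es i ∉ ⊤) → s ≡ t
    edgeless zero vs es s₀ t₀ _ = trans (sym s₀) t₀
    edgeless (suc l) vs es s₀ t₀ avoidsF = contradiction (avoidsF Fin.zero ∈⊤)

Incident : (G : Graph) → E G → V G → Set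
Incident G f x = proj₁ (ends G f) ≡ x ⊎ proj₂ (ends G f) ≡ x

innerEndpoint : {G : Graph} {s t : V G} → ¬ Adjacent G s t → (f : E G) →
                Σ (V G) λ x → x ≢ s × x ≢ t × Incident G f x
innerEndpoint {G} {s} {t} nonadj f
  with proj₁ (ends G f) ≟ s | proj₁ (ends G f) ≟ t | proj₂ (ends G f) ≟ s | proj₂ (ends G f) ≟ t
... | no u≢s | no u≢t | _ | _ = proj₁ (ends G f) , u≢s , u≢t , inj₁ refl
... | _ | _ | no v≢s | no v≢t = proj₂ (ends G f) , v≢s , v≢t , inj₂ refl
... | yes u≡s | _ | yes v≡s | _ = contradiction (noLoop G f (trans u≡s (sym v≡s)))
... | yes u≡s | _ | _ | yes v≡t = contradiction (nonadj (f , inj₁ (u≡s , v≡t)))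
... | _ | yes u≡t | yes v≡s | _ = contradiction (nonadj (f , inj₂ (u≡t , v≡s)))
... | _ | yes u≡t | _ | yes v≡t = contradiction (noLoop G f (trans u≡t (sym v≡t)))

incident-on-path : {G : Graph} {s t : V G} (P : Path G s t) (i : Fin (len P)) {x : V G} →
                   Incident G (edges P i) x → Σ (Fin (suc (len P))) λ j → verts P j ≡ x
incident-on-path P i inc with step P i | inc
... | inj₁ (u≡ , _) | inj₁ u≡x = inject₁ i , trans (sym u≡) u≡x
... | inj₁ (_ , v≡) | inj₂ v≡x = Fin.suc i , trans (sym v≡) v≡x
... | inj₂ (u≡ , _) | inj₁ u≡x = Fin.suc i , trans (sym u≡) u≡x
... | inj₂ (_ , v≡) | inj₂ v≡x = inject₁ i , trans (sym v≡) v≡x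

exchange : {G : Graph} {s t : V G} {W : Subset (n G)} {F : Subset (m G)} {f : E G} {x : V G} →
           x ≢ s → x ≢ t → Incident G f x → Disconnecting G s t W F →
           Disconnecting G s t (W ∪ ⁅ x ⁆) (F - f)
exchange {G} {s} {t} {W} {F} {f} {x} x≢s x≢t inc d =
  record { s∉W = notAdded s (λ s≡x → x≢s (sym s≡x)) (Disconnecting.s∉W d)
         ; t∉W = notAdded t (λ t≡x → x≢t (sym t≡x)) (Disconnecting.t∉W d)
         ; separates = λ (P , avW , avF) →
             Disconnecting.separates d (P , (λ i h → avW i (x∈p∪q⁺ (inj₁ h))) , avoidsF P avW avF) }
  where
  notAdded : ∀ y → y ≢ x → y ∉ W → y ∉ W ∪ ⁅ x ⁆
  notAdded y y≢x y∉W h with x∈p∪q⁻ W ⁅ x ⁆ h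
  ... | inj₁ y∈W = y∉W y∈W
  ... | inj₂ y∈⁅x⁆ = y≢x (x∈⁅y⁆⇒x≡y x y∈⁅x⁆)
  -- f itself cannot be used, since its endpoint x is now a cut vertex.
  avoidsF : (P : Path G s t) → (∀ i → verts P i ∉ W ∪ ⁅ x ⁆) → (∀ i → edges P i ∉ F - f) → ∀ i → edges P i ∉ F
  avoidsF P avW avF i e∈F with edges P i ≟ f
  ... | no e≢f = avF i (x∈p∧x≢y⇒x∈p-y e∈F e≢f)
  ... | yes refl with incident-on-path P i inc
  ...   | j , vj≡x = avW j (subst (_∈ W ∪ ⁅ x ⁆) (sym vj≡x) (x∈p∪q⁺ (inj₂ (x∈⁅x⁆ x))))

-- Lowering the order: if (k+1, 0) is a connectivity pair for distinct s and t,
-- then (k, b) is one for some b ≥ 1.  Take b least such that some cut has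
-- order ≤ k and size ≤ b; every such cut then has size b and, by exchange,
-- order k.
module LowerOrder {G : Graph} {s t : V G} (s≢t : s ≢ t) {k : ℕ} (cp : ConnectivityPair G s t (suc k) 0) where

  CutWithin : ℕ → Set
  CutWithin b = Σ (Subset (n G)) λ W → Σ (Subset (m G)) λ F →
                Disconnecting G s t W F × ∣ W ∣ ≤ k × ∣ F ∣ ≤ b

  cutWithin? : ∀ b → Dec (CutWithin b)
  cutWithin? b = anySubset? λ W → anySubset? λ F →
                   disconnecting? G s t W F ×-dec (∣ W ∣ ≤? k) ×-dec (∣ F ∣ ≤? b)

  allEdgesWithin : CutWithin (m G)
  allEdgesWithin = ⊥ , ⊤ , allEdgesCut s≢t , subst (_≤ k) (sym (∣⊥∣≡0 (n G))) z≤n , ∣p∣≤n ⊤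

  module AtMinimum (b : ℕ) (below : ∀ c → c < b → ¬ CutWithin c) where

    size-exact : ∀ {W F} → Disconnecting G s t W F → ∣ W ∣ ≤ k → ∣ F ∣ ≤ b → ∣ F ∣ ≡ b
    size-exact {W} {F} d w f = ≤-antisym f (≮⇒≥ λ ∣F∣<b → below ∣ F ∣ ∣F∣<b (W , F , d , w , ≤-refl))

    -- A cut of order ≤ k and size 0 would have cardinality < k+1, contradicting cp.
    size-positive : CutWithin b → 1 ≤ b
    size-positive (W , F , d , w , f) = ≮⇒≥ λ b<1 →
      let ∣F∣≡0 = ≤-antisym (≤-trans f (≤-pred b<1)) z≤n in
      ConnectivityPair.minimal cp W F d (m≤n⇒m≤1+n w) (subst (_≤ 0) (sym ∣F∣≡0) z≤n)
        (subst (λ z → ∣ W ∣ + z < suc k + 0) (sym ∣F∣≡0) (+-monoˡ-< 0 (s≤s w)))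

    -- If the order were below k, exchanging a cut edge for an inner endpoint
    -- would give a cut of order ≤ k and size < b.
    order-exact : 1 ≤ b → ∀ {W F} → Disconnecting G s t W F → ∣ W ∣ ≤ k → ∣ F ∣ ≡ b → ∣ W ∣ ≡ k
    order-exact 1≤b {W} {F} d w ∣F∣≡b = ≤-antisym w (≮⇒≥ shrink)
      where
      shrink : ∣ W ∣ < k → Empty
      shrink ∣W∣<k with positive⇒nonempty F (subst (0 <_) (sym ∣F∣≡b) 1≤b)
      ... | f , f∈F with innerEndpoint {G} {s} {t} (vertexCut⇒nonadjacent s≢t cp) f
      ...   | x , x≢s , x≢t , inc =
        below ∣ F - f ∣ (subst (∣ F - f ∣ <_) ∣F∣≡b (x∈p⇒∣p-x∣<∣p∣ f∈F))
          (W ∪ ⁅ x ⁆ , F - f , exchange x≢s x≢t inc d , order≤k , ≤-refl)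
        where
        order≤k : ∣ W ∪ ⁅ x ⁆ ∣ ≤ k
        order≤k = ≤-trans (∣p∪q∣≤∣p∣+∣q∣ W ⁅ x ⁆)
                    (subst (λ z → ∣ W ∣ + z ≤ k) (sym (∣⁅x⁆∣≡1 x)) (subst (_≤ k) (+-comm 1 ∣ W ∣) ∣W∣<k))

    connectivityPair : CutWithin b → ConnectivityPair G s t k b
    connectivityPair cut@(W , F , d , w , f) =
      record { witness = W , F , d , order-exact 1≤b d w (size-exact d w f) , size-exact d w f
             ; minimal = λ W′ F′ d′ w′ f′ lt →
                 <-irrefl refl (subst₂ (λ x y → x + y < k + b) (order-exact 1≤b d′ w′ (size-exact d′ w′ f′))
                                       (size-exact d′ w′ f′) lt) }
      where 1≤b = size-positive cut

  fromLeast : Least CutWithin → Σ ℕ λ b → 1 ≤ b × ConnectivityPair G s t k b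
  fromLeast (b , cut , below) = b , size-positive cut , connectivityPair cut
    where open AtMinimum b below

lowerOrder : {G : Graph} {s t : V G} → s ≢ t → ∀ {k} → ConnectivityPair G s t (suc k) 0 →
             Σ ℕ λ b → 1 ≤ b × ConnectivityPair G s t k b
lowerOrder s≢t cp = fromLeast (least cutWithin? allEdgesWithin)
  where open LowerOrder s≢t cp

-- N pairwise edge-disjoint s–t paths, those with index ≤ c pairwise
-- internally disjoint; PathSystem G s t k l is PathFamily G s t (k + l) k.
PathFamily : (G : Graph) (s t : V G) (N c : ℕ) → Set
PathFamily G s t N c =
  Σ (Fin N → Path G s t) λ P → (∀ i j → i ≢ j → EdgeDisjoint (P i) (P j)) ×
    (∀ i j → toℕ i ≤ c → toℕ j ≤ c → i ≢ j → InternallyDisjoint (P i) (P j))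

module _ {G : Graph} {s t : V G} where

  noPaths : ∀ {c} → PathFamily G s t 0 c
  noPaths = (λ ()) , (λ ()) , λ ()

  weaken : ∀ {N c c′} → c′ ≤ c → PathFamily G s t N c → PathFamily G s t N c′
  weaken c′≤c (P , edgeDisj , intDisj) =
    P , edgeDisj , λ i j i≤c′ j≤c′ → intDisj i j (≤-trans i≤c′ c′≤c) (≤-trans j≤c′ c′≤c)

  take : ∀ {M N c} → M ≤ N → PathFamily G s t N c → PathFamily G s t M c
  take M≤N (P , edgeDisj , intDisj) =
    (λ i → P (inject≤ i M≤N)) ,
    (λ i j i≢j → edgeDisj _ _ (λ eq → i≢j (inject≤-injective M≤N M≤N i j eq))) ,
    (λ i j i≤c j≤c i≢j → intDisj _ _ (subst (_≤ _) (sym (toℕ-inject≤ i M≤N)) i≤c)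
                                     (subst (_≤ _) (sym (toℕ-inject≤ j M≤N)) j≤c)
                                     (λ eq → i≢j (inject≤-injective M≤N M≤N i j eq)))

  resize : ∀ {N N′ c} → N ≡ N′ → PathFamily G s t N c → PathFamily G s t N′ c
  resize {c = c} = subst (λ N → PathFamily G s t N c)

module Deletion {N M : ℕ} (ends′ : Fin (suc M) → Fin N × Fin N)
                (noLoop′ : ∀ f → proj₁ (ends′ f) ≢ proj₂ (ends′ f)) (e : Fin (suc M)) where

  G : Graph
  G = record { n = N ; m = suc M ; ends = ends′ ; noLoop = noLoop′ }

  G∖e : Graph
  G∖e = deleteEdge G M refl e

  module _ {s t : Fin N} where

    -- Paths of G - e are the paths of G not using e; edge j of G - e is edge punchIn e j of G.
    liftPath : Path G∖e s t → Path G s t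
    liftPath P = record { len = len P ; verts = verts P ; edges = λ i → punchIn e (edges P i)
                        ; start = start P ; end = end P ; simple = simple P ; step = step P }

    lowerPath : (P : Path G s t) → (∀ i → e ≢ edges P i) → Path G∖e s t
    lowerPath P avoidsE =
      record { len = len P ; verts = verts P ; edges = λ i → punchOut (avoidsE i)
             ; start = start P ; end = end P ; simple = simple P
             ; step = λ i → subst (λ f → Joins G f _ _) (sym (punchIn-punchOut (avoidsE i))) (step P i) }

    lowerCut : ∀ {W F} → Disconnecting G s t W (insertAt F e inside) → Disconnecting G∖e s t W F
    lowerCut d = record
      { s∉W = Disconnecting.s∉W d ; t∉W = Disconnecting.t∉W d
      ; separates = λ (P , avW , avF) →
          Disconnecting.separates d (liftPath P , avW , λ i h → avF i (∈insertAt⁻ e h)) }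

    liftCut : ∀ {W F} → Disconnecting G∖e s t W F → Disconnecting G s t W (insertAt F e inside)
    liftCut {W} {F} d = record
      { s∉W = Disconnecting.s∉W d ; t∉W = Disconnecting.t∉W d
      ; separates = λ (P , avW , avF) →
          let avoidsE : ∀ i → e ≢ edges P i
              avoidsE i e≡ = avF i (subst (_∈ insertAt F e inside) e≡ (i∈insertAt F e))
          in Disconnecting.separates d
               (lowerPath P avoidsE , avW ,
                λ i h → avF i (subst (_∈ insertAt F e inside) (punchIn-punchOut (avoidsE i)) (∈insertAt⁺ e h))) }

    -- The s–t edge e belongs to every cut, so removing it lowers the size by one.
    dropEdge : s ≢ t → Joins G e s t → ∀ {k l} → ConnectivityPair G s t k (suc l) → ConnectivityPair G∖e s t k l
    dropEdge s≢t J {k} {l} cp with ConnectivityPair.witness cp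
    ... | W , F , d , ∣W∣≡k , ∣F∣≡1+l =
      record { witness = W , removeAt F e , lowerCut (subst (Disconnecting G s t W) (sym F≡) d) , ∣W∣≡k ,
                         suc-injective (trans (sym (∣insertAt-inside∣ (removeAt F e) e)) (trans (cong ∣_∣ F≡) ∣F∣≡1+l))
             ; minimal = λ W′ F′ d′ w f lt →
                 ConnectivityPair.minimal cp W′ (insertAt F′ e inside) (liftCut d′) w
                   (subst (_≤ suc l) (sym (∣insertAt-inside∣ F′ e)) (s≤s f))
                   (subst₂ _<_ (sym (trans (cong (∣ W′ ∣ +_) (∣insertAt-inside∣ F′ e)) (+-suc ∣ W′ ∣ ∣ F′ ∣)))
                               (sym (+-suc k l)) (s≤s lt)) }
      where
      F≡ : insertAt (removeAt F e) e inside ≡ F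
      F≡ = insertAt-removeAt-∈ (edge∈cut s≢t J d)

    prepend : s ≢ t → Joins G e s t → ∀ {K c} → PathFamily G∖e s t K c → PathFamily G s t (suc K) (suc c)
    prepend s≢t J {K} {c} (P , edgeDisj , intDisj) = Q , edgeDisj′ , intDisj′
      where
      Q : Fin (suc K) → Path G s t
      Q Fin.zero = edgePath s≢t e J
      Q (Fin.suc i) = liftPath (P i)
      edgeDisj′ : ∀ i j → i ≢ j → EdgeDisjoint (Q i) (Q j)
      edgeDisj′ Fin.zero Fin.zero i≢j = contradiction (i≢j refl)
      edgeDisj′ Fin.zero (Fin.suc j) _ _ _ eq = punchInᵢ≢i e _ (sym eq)
      edgeDisj′ (Fin.suc i) Fin.zero _ _ _ eq = punchInᵢ≢i e _ eq
      edgeDisj′ (Fin.suc i) (Fin.suc j) i≢j a b eq =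
        edgeDisj i j (λ i≡j → i≢j (cong Fin.suc i≡j)) a b (punchIn-injective e _ _ eq)
      intDisj′ : ∀ i j → toℕ i ≤ suc c → toℕ j ≤ suc c → i ≢ j → InternallyDisjoint (Q i) (Q j)
      intDisj′ Fin.zero Fin.zero _ _ i≢j = contradiction (i≢j refl)
      intDisj′ Fin.zero (Fin.suc j) _ _ _ a _ _ = edgePath-verts s≢t e J a
      intDisj′ (Fin.suc i) Fin.zero _ _ _ _ b eq with edgePath-verts s≢t e J b
      ... | inj₁ ≡s = inj₁ (trans eq ≡s)
      ... | inj₂ ≡t = inj₂ (trans eq ≡t)
      intDisj′ (Fin.suc i) (Fin.suc j) (s≤s i≤c) (s≤s j≤c) i≢j =
        intDisj i j i≤c j≤c (λ i≡j → i≢j (cong Fin.suc i≡j))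

    -- The property transfers from G - e to G.  For size l+2 use the pair (k, l+1)
    -- of G - e; for size 1 the pair (k, 0) of G - e, lowered to (k-1, b) if k > 0.
    transfer : s ≢ t → Joins G e s t → Property G∖e s t → Property G s t
    transfer s≢t J ih k (suc (suc l)) _ cp =
      resize (sym (+-suc k (suc l)))
        (weaken (n≤1+n k) (prepend s≢t J (ih k (suc l) (s≤s z≤n) (dropEdge s≢t J cp))))
    transfer s≢t J ih zero (suc zero) _ cp = weaken z≤n (prepend s≢t J (noPaths {c = 0}))
    transfer s≢t J ih (suc k) (suc zero) _ cp with lowerOrder s≢t (dropEdge s≢t J cp)
    ... | b , 1≤b , cp′ =
      resize (cong suc (+-comm 1 k))
        (prepend s≢t J (take (subst (_≤ k + b) (+-comm k 1) (+-monoʳ-≤ k 1≤b)) (ih k b 1≤b cp′)))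

mainTheorem9 : (𝒢 : Graph → Set) → ClosedUnderEdgeDeletion 𝒢 →
    (∀ G → 𝒢 G → (s t : V G) → s ≢ t → ¬ Adjacent G s t → Property G s t) →
    ∀ G → 𝒢 G → (s t : V G) → s ≢ t → Property G s t
mainTheorem9 𝒢 closed nonadjacentCase G g = byEdgeCount (m G) G refl g
  where
  byEdgeCount : ∀ M G → m G ≡ M → 𝒢 G → (s t : V G) → s ≢ t → Property G s t
  byEdgeCount zero G@record { } refl g s t s≢t = nonadjacentCase G g s t s≢t λ { (() , _) }
  byEdgeCount (suc M) G@record { ends = ends′ ; noLoop = noLoop′ } refl g s t s≢t with adjacent? G s t
  ... | no nonadj = nonadjacentCase G g s t s≢t nonadj
  ... | yes (e , J) =
    Deletion.transfer ends′ noLoop′ e s≢t J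
      (byEdgeCount M (deleteEdge G M refl e) refl (closed G g M refl e) s t s≢t)
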